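{- For every integer $k \geq 1$, every graph with average degree at least $8k$ (in particular, every $8k$-connected graph) contains a $(k+1)$-connected bipartite subgraph.
   Context: All graphs are finite and simple. The average degree of a graph $G$ with at least one vertex is $2|E(G)|/|V(G)|$. -}

module Defs where

open import Data.Nat using (ℕ; zero; suc; _+_; _*_; _≤_; _<_; _<ᵇ_)
open import Data.Fin using (Fin; toℕ) renaming (zero to fzero; suc to fsuc)
open import Data.Bool using (Bool; true; false; if_then_else_; _∧_)
open import Data.Product using (Σ; _×_; _,_; ∃)
open import Relation.Binary.PropositionalEquality using (_≡_; _≢_)
open import Relation.Binary.Construct.Closure.ReflexiveTransitive using (Star)

record Graph (n : ℕ) : Set where
  field
    adj   : Fin n → Fin n → Bool
    sym   : ∀ i j → adj i j ≡ adj j i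
    irrefl : ∀ i → adj i i ≡ false
open Graph public

count : ∀ {n} → (Fin n → Bool) → ℕ
count {zero}  f = 0
count {suc n} f = (if f fzero then 1 else 0) + count (λ i → f (fsuc i))

sumFin : ∀ {n} → (Fin n → ℕ) → ℕ
sumFin {zero}  f = 0
sumFin {suc n} f = f fzero + sumFin (λ i → f (fsuc i))

edgeCount : ∀ {n} → Graph n → ℕ
edgeCount {n} G = sumFin (λ i → count (λ j → (toℕ i <ᵇ toℕ j) ∧ adj G i j))

AvgDegreeAtLeast : ∀ {n} → Graph n → ℕ → Set
AvgDegreeAtLeast {n} G d = 1 ≤ n × d * n ≤ 2 * edgeCount G

-- A subgraph of G (on the same ambient vertex type Fin n): a vertex set V
-- together with a simple graph H whose edges are edges of G with both ends in V.
record Subgraph {n : ℕ} (G : Graph n) : Set where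
  field
    inV   : Fin n → Bool
    graph : Graph n
    edge-sub : ∀ i j → adj graph i j ≡ true → adj G i j ≡ true
    edge-in  : ∀ i j → adj graph i j ≡ true → inV i ≡ true × inV j ≡ true
open Subgraph public

IsBipartite : ∀ {n} {G : Graph n} → Subgraph G → Set
IsBipartite {n} H = Σ (Fin n → Bool) λ c → ∀ i j → adj (graph H) i j ≡ true → c i ≢ c j

StepAvoiding : ∀ {n} {G : Graph n} → Subgraph G → (Fin n → Bool) → Fin n → Fin n → Set
StepAvoiding H X u v = adj (graph H) u v ≡ true × X v ≡ false

InMinus : ∀ {n} {G : Graph n} → Subgraph G → (Fin n → Bool) → Fin n → Set
InMinus H X v = inV H v ≡ true × X v ≡ false

ConnectedMinus : ∀ {n} {G : Graph n} → Subgraph G → (Fin n → Bool) → Set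
ConnectedMinus H X = ∀ u v → InMinus H X u → InMinus H X v → Star (StepAvoiding H X) u v

IsKConnected : ∀ {n} {G : Graph n} → ℕ → Subgraph G → Set
IsKConnected {n} m H =
  m < count (inV H) × (∀ (X : Fin n → Bool) → count X < m → ConnectedMinus H X)

module Submission where

-- Colour the vertices one at a time so that each vertex has at least half of its later
-- neighbours in the other class; the edges between the classes form a bipartite graph B
-- with at least half of the edges of G, hence of average degree at least 4k.
-- Following Mader, call S dense if |S| ≥ 2k and e(B[S]) > 2k|S| − 2k². The whole vertex
-- set is dense; take a dense S of minimum size. Deleting a vertex of degree ≤ 2k would
-- leave a smaller dense set, so B[S] has minimum degree > 2k. If some X with |X| ≤ k
-- separated B[S], with C the component of a vertex, then S ∩ (C ∪ X) and S ∖ C would be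
-- smaller than S, contain more than 2k vertices each (each contains a neighbourhood),
-- hence not be dense; adding up, e(B[S]) ≤ 2k(|S| + |X|) − 4k² ≤ 2k|S| − 2k², which
-- contradicts the density of S. So B[S] is (k+1)-connected.

open import Defs renaming (sym to adj-sym; irrefl to adj-irrefl)
open import Data.Bool using (Bool; true; false; if_then_else_; _∧_; _∨_; not; _xor_)
open import Data.Bool.Properties using (∧-zeroʳ; ∨-identityʳ; ∨-zeroʳ) renaming (_≟_ to _≟ᵇ_)
open import Data.Empty using (⊥; ⊥-elim)
open import Data.Fin using (Fin; toℕ; _≟_) renaming (zero to fzero; suc to fsuc)
open import Data.Fin.Properties using (any?)
open import Data.Fin.Subset.Properties using (anySubset?)
open import Data.Nat using (ℕ; zero; suc; _+_; _*_; _≤_; _<_; _<ᵇ_; z≤n; s≤s; s≤s⁻¹; _≤?_; _<?_; >-nonZero)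
open import Data.Nat.Properties hiding (_≟_)
open import Data.Nat.Tactic.RingSolver using (solve-∀)
open import Data.Product using (Σ; Σ-syntax; _×_; _,_; proj₁; proj₂)
open import Data.Sum using (_⊎_; inj₁; inj₂)
open import Data.Vec using (lookup; tabulate)
open import Data.Vec.Functional using (_∷_)
open import Data.Vec.Properties using (lookup∘tabulate)
open import Relation.Binary.Construct.Closure.ReflexiveTransitive using (Star; ε; _◅_; _◅◅_)
open import Relation.Binary.PropositionalEquality
  using (_≡_; _≢_; refl; sym; trans; cong; cong₂; subst; subst₂; module ≡-Reasoning)
open import Relation.Nullary using (Dec; yes; no; ¬_; does)
open import Relation.Nullary.Decidable using (dec-true; _×-dec_)

𝟙[_] : Bool → ℕ
𝟙[ b ] = if b then 1 else 0

𝟙-mono : ∀ {x y} → (x ≡ true → y ≡ true) → 𝟙[ x ] ≤ 𝟙[ y ]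
𝟙-mono {false} x⇒y = z≤n
𝟙-mono {true}  x⇒y rewrite x⇒y refl = ≤-refl

∧-elimˡ : ∀ {x y} → x ∧ y ≡ true → x ≡ true
∧-elimˡ {true} _ = refl

∧-elimʳ : ∀ {x y} → x ∧ y ≡ true → y ≡ true
∧-elimʳ {true} y≡true = y≡true

-- Counting over Fin n

sumFin-cong : ∀ {n} {f g : Fin n → ℕ} → (∀ i → f i ≡ g i) → sumFin f ≡ sumFin g
sumFin-cong {zero}  f≗g = refl
sumFin-cong {suc n} f≗g = cong₂ _+_ (f≗g fzero) (sumFin-cong (λ i → f≗g (fsuc i)))

sumFin-mono-≤ : ∀ {n} {f g : Fin n → ℕ} → (∀ i → f i ≤ g i) → sumFin f ≤ sumFin g
sumFin-mono-≤ {zero}  f≤g = z≤n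
sumFin-mono-≤ {suc n} f≤g = +-mono-≤ (f≤g fzero) (sumFin-mono-≤ (λ i → f≤g (fsuc i)))

sumFin-mono-< : ∀ {n} {f g : Fin n → ℕ} → (∀ i → f i ≤ g i) → ∀ v → f v < g v → sumFin f < sumFin g
sumFin-mono-< {suc n} f≤g fzero    fv<gv = +-mono-<-≤ fv<gv (sumFin-mono-≤ (λ i → f≤g (fsuc i)))
sumFin-mono-< {suc n} f≤g (fsuc v) fv<gv = +-mono-≤-< (f≤g fzero) (sumFin-mono-< (λ i → f≤g (fsuc i)) v fv<gv)

sumFin-zero : ∀ n → sumFin {n} (λ _ → 0) ≡ 0
sumFin-zero zero    = refl
sumFin-zero (suc n) = sumFin-zero n

sumFin-distrib-+ : ∀ {n} (f g : Fin n → ℕ) → sumFin (λ i → f i + g i) ≡ sumFin f + sumFin g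
sumFin-distrib-+ {zero}  f g = refl
sumFin-distrib-+ {suc n} f g =
  trans (cong (f fzero + g fzero +_) (sumFin-distrib-+ (λ i → f (fsuc i)) (λ i → g (fsuc i))))
        (interchange (f fzero) (g fzero) _ _)
  where
  interchange : ∀ a b c d → a + b + (c + d) ≡ a + c + (b + d)
  interchange = solve-∀

sumFin-distribˡ-* : ∀ {n} m (f : Fin n → ℕ) → sumFin (λ i → m * f i) ≡ m * sumFin f
sumFin-distribˡ-* {zero}  m f = sym (*-zeroʳ m)
sumFin-distribˡ-* {suc n} m f =
  trans (cong (m * f fzero +_) (sumFin-distribˡ-* m (λ i → f (fsuc i))))
        (sym (*-distribˡ-+ m (f fzero) _))

sumFin-comm : ∀ {m n} (f : Fin m → Fin n → ℕ) →
              sumFin (λ i → sumFin (f i)) ≡ sumFin (λ j → sumFin (λ i → f i j))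
sumFin-comm {zero}  {n} f = sym (sumFin-zero n)
sumFin-comm {suc m} {n} f =
  trans (cong (sumFin (f fzero) +_) (sumFin-comm (λ i → f (fsuc i))))
        (sym (sumFin-distrib-+ (f fzero) (λ j → sumFin (λ i → f (fsuc i) j))))

sumFin-single : ∀ {n} (u : Fin n) (x : ℕ) → sumFin (λ i → if does (i ≟ u) then x else 0) ≡ x
sumFin-single {suc n} fzero    x = trans (cong (x +_) (sumFin-zero n)) (+-identityʳ x)
sumFin-single {suc n} (fsuc u) x = sumFin-single u x

sumFin-if : ∀ {n} b (f : Fin n → ℕ) → sumFin (λ j → if b then f j else 0) ≡ (if b then sumFin f else 0)
sumFin-if true  f = refl
sumFin-if {n} false f = sumFin-zero n

sumFin²-mono : ∀ {n} {f g h : Fin n → Fin n → ℕ} → (∀ i j → f i j ≤ g i j + h i j) →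
               sumFin (λ i → sumFin (f i)) ≤ sumFin (λ i → sumFin (g i)) + sumFin (λ i → sumFin (h i))
sumFin²-mono {f = f} {g} {h} f≤g+h = begin
  sumFin (λ i → sumFin (f i))                                   ≤⟨ sumFin-mono-≤ (λ i → sumFin-mono-≤ (f≤g+h i)) ⟩
  sumFin (λ i → sumFin (λ j → g i j + h i j))                   ≡⟨ sumFin-cong (λ i → sumFin-distrib-+ (g i) (h i)) ⟩
  sumFin (λ i → sumFin (g i) + sumFin (h i))                    ≡⟨ sumFin-distrib-+ (λ i → sumFin (g i)) (λ i → sumFin (h i)) ⟩
  sumFin (λ i → sumFin (g i)) + sumFin (λ i → sumFin (h i))     ∎
  where open ≤-Reasoning

count≡sumFin : ∀ {n} (f : Fin n → Bool) → count f ≡ sumFin (λ i → 𝟙[ f i ])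
count≡sumFin {zero}  f = refl
count≡sumFin {suc n} f = cong (𝟙[ f fzero ] +_) (count≡sumFin (λ i → f (fsuc i)))

count-cong : ∀ {n} {f g : Fin n → Bool} → (∀ i → f i ≡ g i) → count f ≡ count g
count-cong {zero}  f≗g = refl
count-cong {suc n} f≗g = cong₂ _+_ (cong 𝟙[_] (f≗g fzero)) (count-cong (λ i → f≗g (fsuc i)))

_⊆_ : ∀ {n} → (Fin n → Bool) → (Fin n → Bool) → Set
S ⊆ T = ∀ i → S i ≡ true → T i ≡ true

count-mono : ∀ {n} {S T : Fin n → Bool} → S ⊆ T → count S ≤ count T
count-mono {S = S} {T} S⊆T = subst₂ _≤_ (sym (count≡sumFin S)) (sym (count≡sumFin T))
  (sumFin-mono-≤ (λ i → 𝟙-mono (S⊆T i)))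

count-mono-< : ∀ {n} {S T : Fin n → Bool} → S ⊆ T → ∀ v → S v ≡ false → T v ≡ true → count S < count T
count-mono-< {S = S} {T} S⊆T v Sv Tv = subst₂ _<_ (sym (count≡sumFin S)) (sym (count≡sumFin T))
  (sumFin-mono-< (λ i → 𝟙-mono (S⊆T i)) v (subst₂ (λ x y → 𝟙[ x ] < 𝟙[ y ]) (sym Sv) (sym Tv) ≤-refl))

count-all : ∀ n → count {n} (λ _ → true) ≡ n
count-all zero    = refl
count-all (suc n) = cong suc (count-all n)

count≤n : ∀ {n} (S : Fin n → Bool) → count S ≤ n
count≤n {n} S = subst (count S ≤_) (count-all n) (count-mono {n} {S} {λ _ → true} (λ _ _ → refl))

count-split : ∀ {n} (f g : Fin n → Bool) →
              count (λ i → f i ∧ not (g i)) + count (λ i → f i ∧ g i) ≡ count f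
count-split {zero}  f g = refl
count-split {suc n} f g =
  trans (interchange 𝟙[ f fzero ∧ not (g fzero) ] 𝟙[ f fzero ∧ g fzero ] _ _)
        (cong₂ _+_ (split (f fzero) (g fzero)) (count-split (λ i → f (fsuc i)) (λ i → g (fsuc i))))
  where
  interchange : ∀ a b c d → a + c + (b + d) ≡ a + b + (c + d)
  interchange = solve-∀
  split : ∀ x y → 𝟙[ x ∧ not y ] + 𝟙[ x ∧ y ] ≡ 𝟙[ x ]
  split false y     = refl
  split true  false = refl
  split true  true  = refl

count-none : ∀ n → count {n} (λ _ → false) ≡ 0
count-none zero    = refl
count-none (suc n) = count-none n

-- Induced subgraphs and degree sums

_∩_ _∪_ : ∀ {n} → (Fin n → Bool) → (Fin n → Bool) → Fin n → Bool
(S ∩ T) i = S i ∧ T i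
(S ∪ T) i = S i ∨ T i

∁ : ∀ {n} → (Fin n → Bool) → Fin n → Bool
∁ S i = not (S i)

⁅_⁆ : ∀ {n} → Fin n → Fin n → Bool
⁅ u ⁆ i = does (i ≟ u)

∈⁅⁆⇒≡ : ∀ {n} {i u : Fin n} → ⁅ u ⁆ i ≡ true → i ≡ u
∈⁅⁆⇒≡ {i = i} {u} i∈⁅u⁆ with i ≟ u | i∈⁅u⁆
... | yes i≡u | _ = i≡u

_─_ : ∀ {n} → (Fin n → Bool) → Fin n → Fin n → Bool
(S ─ u) i = if does (i ≟ u) then false else S i

count-remove : ∀ {n} {S : Fin n → Bool} {u} → S u ≡ true → count S ≡ suc (count (S ─ u))
count-remove {S = S} {u} Su = begin
  count S                                                       ≡⟨ count≡sumFin S ⟩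
  sumFin (λ i → 𝟙[ S i ])                                       ≡⟨ sumFin-cong split ⟩
  sumFin (λ i → (if does (i ≟ u) then 1 else 0) + 𝟙[ (S ─ u) i ]) ≡⟨ sumFin-distrib-+ _ (λ i → 𝟙[ (S ─ u) i ]) ⟩
  sumFin (λ i → if does (i ≟ u) then 1 else 0) + sumFin (λ i → 𝟙[ (S ─ u) i ])
                                                                ≡⟨ cong₂ _+_ (sumFin-single u 1) (sym (count≡sumFin (S ─ u))) ⟩
  suc (count (S ─ u))                                           ∎
  where
  open ≡-Reasoning
  split : ∀ i → 𝟙[ S i ] ≡ (if does (i ≟ u) then 1 else 0) + 𝟙[ (S ─ u) i ]
  split i with i ≟ u
  ... | yes refl = cong 𝟙[_] Su
  ... | no _     = refl

_[_] : ∀ {n} → Graph n → (Fin n → Bool) → Graph n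
adj (G [ S ]) i j = S i ∧ S j ∧ adj G i j
adj-sym (G [ S ]) i j = trans (cong (λ e → S i ∧ S j ∧ e) (adj-sym G i j)) (swap (S i) (S j) (adj G j i))
  where
  swap : ∀ x y z → x ∧ y ∧ z ≡ y ∧ x ∧ z
  swap false false z = refl
  swap false true  z = refl
  swap true  false z = refl
  swap true  true  z = refl
adj-irrefl (G [ S ]) i =
  trans (cong (λ e → S i ∧ S i ∧ e) (adj-irrefl G i)) (trans (cong (S i ∧_) (∧-zeroʳ (S i))) (∧-zeroʳ (S i)))

induced : ∀ {n} (G : Graph n) → (Fin n → Bool) → Subgraph G
inV (induced G S) = S
graph (induced G S) = G [ S ]
edge-sub (induced G S) i j e = ∧-elimʳ {S j} (∧-elimʳ {S i} e)
edge-in (induced G S) i j e = ∧-elimˡ e , ∧-elimˡ (∧-elimʳ {S i} e)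

_⊆ᴳ_ : ∀ {n} → Graph n → Graph n → Set
G ⊆ᴳ G′ = ∀ i j → adj G i j ≡ true → adj G′ i j ≡ true

Subgraph-mono : ∀ {n} {G G′ : Graph n} → G ⊆ᴳ G′ → Subgraph G → Subgraph G′
inV (Subgraph-mono _ H) = inV H
graph (Subgraph-mono _ H) = graph H
edge-sub (Subgraph-mono G⊆G′ H) i j e = G⊆G′ i j (edge-sub H i j e)
edge-in (Subgraph-mono _ H) = edge-in H

degree : ∀ {n} → Graph n → Fin n → ℕ
degree G i = count (adj G i)

degreeSum : ∀ {n} → Graph n → ℕ
degreeSum G = sumFin (degree G)

degreeSum≡sumFin² : ∀ {n} (G : Graph n) → degreeSum G ≡ sumFin (λ i → sumFin (λ j → 𝟙[ adj G i j ]))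
degreeSum≡sumFin² G = sumFin-cong (λ i → count≡sumFin (adj G i))

degreeSum-cong : ∀ {n} (G : Graph n) {S T : Fin n → Bool} → (∀ i → S i ≡ T i) →
                 degreeSum (G [ S ]) ≡ degreeSum (G [ T ])
degreeSum-cong G S≗T =
  sumFin-cong (λ i → count-cong (λ j → cong₂ (λ x y → x ∧ y ∧ adj G i j) (S≗T i) (S≗T j)))

<ᵇ-asym : ∀ m k → (m <ᵇ k) ∧ (k <ᵇ m) ≡ false
<ᵇ-asym zero    zero    = refl
<ᵇ-asym zero    (suc k) = refl
<ᵇ-asym (suc m) zero    = refl
<ᵇ-asym (suc m) (suc k) = <ᵇ-asym m k

edgeCount-lower : ∀ {n} (G : Graph n) →
                  edgeCount G ≡ sumFin (λ i → count (λ j → (toℕ j <ᵇ toℕ i) ∧ adj G i j))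
edgeCount-lower {n} G = begin
  sumFin (λ i → count (upper i))                 ≡⟨ sumFin-cong (λ i → count≡sumFin (upper i)) ⟩
  sumFin (λ i → sumFin (λ j → 𝟙[ upper i j ]))   ≡⟨ sumFin-comm (λ i j → 𝟙[ upper i j ]) ⟩
  sumFin (λ j → sumFin (λ i → 𝟙[ upper i j ]))   ≡⟨ sumFin-cong (λ j → sumFin-cong (λ i →
                                                      cong (λ e → 𝟙[ (toℕ i <ᵇ toℕ j) ∧ e ]) (adj-sym G i j))) ⟩
  sumFin (λ j → sumFin (λ i → 𝟙[ lower j i ]))   ≡⟨ sym (sumFin-cong (λ j → count≡sumFin (lower j))) ⟩
  sumFin (λ j → count (lower j))                 ∎
  where
  open ≡-Reasoning
  upper lower : Fin n → Fin n → Bool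
  upper i j = (toℕ i <ᵇ toℕ j) ∧ adj G i j
  lower i j = (toℕ j <ᵇ toℕ i) ∧ adj G i j

2*edgeCount≤degreeSum : ∀ {n} (G : Graph n) → 2 * edgeCount G ≤ degreeSum G
2*edgeCount≤degreeSum {n} G = begin
  2 * edgeCount G                                          ≡⟨ cong (edgeCount G +_) (+-identityʳ (edgeCount G)) ⟩
  edgeCount G + edgeCount G                                ≡⟨ cong (edgeCount G +_) (edgeCount-lower G) ⟩
  sumFin (λ i → count (upper i)) + sumFin (λ i → count (lower i))
                                                           ≡⟨ sym (sumFin-distrib-+ (λ i → count (upper i)) _) ⟩
  sumFin (λ i → count (upper i) + count (lower i))         ≤⟨ sumFin-mono-≤ row ⟩
  degreeSum G                                              ∎
  where
  open ≤-Reasoning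
  upper lower : Fin n → Fin n → Bool
  upper i j = (toℕ i <ᵇ toℕ j) ∧ adj G i j
  lower i j = (toℕ j <ᵇ toℕ i) ∧ adj G i j

  disjoint : ∀ x y a → x ∧ y ≡ false → 𝟙[ x ∧ a ] + 𝟙[ y ∧ a ] ≤ 𝟙[ a ]
  disjoint false false a     _  = z≤n
  disjoint false true  a     _  = ≤-refl
  disjoint true  false a     _  = ≤-reflexive (+-identityʳ 𝟙[ a ])
  disjoint true  true  false _  = z≤n

  row : ∀ i → count (upper i) + count (lower i) ≤ degree G i
  row i = subst₂ _≤_
    (trans (sumFin-distrib-+ (λ j → 𝟙[ upper i j ]) (λ j → 𝟙[ lower i j ]))
           (sym (cong₂ _+_ (count≡sumFin (upper i)) (count≡sumFin (lower i)))))
    (sym (count≡sumFin (adj G i)))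
    (sumFin-mono-≤ (λ j → disjoint (toℕ i <ᵇ toℕ j) (toℕ j <ᵇ toℕ i) (adj G i j) (<ᵇ-asym (toℕ i) (toℕ j))))

degreeSum+order≤order² : ∀ {n} (G : Graph n) (S : Fin n → Bool) →
                         degreeSum (G [ S ]) + count S ≤ count S * count S
degreeSum+order≤order² {n} G S = begin
  degreeSum (G [ S ]) + count S                          ≡⟨ cong (degreeSum (G [ S ]) +_) (count≡sumFin S) ⟩
  degreeSum (G [ S ]) + sumFin (λ i → 𝟙[ S i ])          ≡⟨ sym (sumFin-distrib-+ (degree (G [ S ])) _) ⟩
  sumFin (λ i → degree (G [ S ]) i + 𝟙[ S i ])           ≤⟨ sumFin-mono-≤ (λ i → row i (S i) refl) ⟩
  sumFin (λ i → count S * 𝟙[ S i ])                      ≡⟨ sumFin-distribˡ-* (count S) (λ i → 𝟙[ S i ]) ⟩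
  count S * sumFin (λ i → 𝟙[ S i ])                      ≡⟨ cong (count S *_) (sym (count≡sumFin S)) ⟩
  count S * count S                                      ∎
  where
  open ≤-Reasoning
  row : ∀ i s → S i ≡ s → count (λ j → s ∧ S j ∧ adj G i j) + 𝟙[ s ] ≤ count S * 𝟙[ s ]
  row i false _  = ≤-reflexive (trans (+-identityʳ _) (trans (count-none n) (sym (*-zeroʳ (count S)))))
  row i true  Si = subst₂ _≤_ (+-comm 1 _) (sym (*-identityʳ (count S)))
    (count-mono-< (λ j → ∧-elimˡ) i (trans (cong (S i ∧_) (adj-irrefl G i)) (∧-zeroʳ (S i))) Si)

degreeSum-remove : ∀ {n} (G : Graph n) (S : Fin n → Bool) (u : Fin n) →
                   degreeSum (G [ S ]) ≤ degreeSum (G [ S ─ u ]) + 2 * degree (G [ S ]) u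
degreeSum-remove {n} G S u = let open ≤-Reasoning in begin
  degreeSum (G [ S ])                                              ≡⟨ degreeSum≡sumFin² (G [ S ]) ⟩
  sumFin (λ i → sumFin (λ j → 𝟙[ e i j ]))                         ≤⟨ sumFin²-mono split ⟩
  sumFin (λ i → sumFin (λ j → 𝟙[ e′ i j ])) + sumFin (λ i → sumFin (λ j → at-u i j))
                                                                   ≡⟨ cong₂ _+_ (sym (degreeSum≡sumFin² (G [ S ─ u ]))) incident ⟩
  degreeSum (G [ S ─ u ]) + 2 * degree (G [ S ]) u                  ∎
  where
  e e′ : Fin n → Fin n → Bool
  e  = adj (G [ S ])
  e′ = adj (G [ S ─ u ])

  at-u : Fin n → Fin n → ℕ
  at-u i j = (if does (i ≟ u) then 𝟙[ e u j ] else 0) + (if does (j ≟ u) then 𝟙[ e i u ] else 0)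

  split : ∀ i j → 𝟙[ e i j ] ≤ 𝟙[ e′ i j ] + at-u i j
  split i j with i ≟ u
  ... | yes refl = m≤m+n 𝟙[ e i j ] _
  ... | no _ with j ≟ u
  ...   | yes refl = m≤n+m 𝟙[ e i j ] _
  ...   | no _     = m≤m+n 𝟙[ e i j ] 0

  d : ℕ
  d = degree (G [ S ]) u

  incident : sumFin (λ i → sumFin (at-u i)) ≡ 2 * d
  incident = begin
    sumFin (λ i → sumFin (at-u i))
      ≡⟨ sumFin-cong (λ i → sumFin-distrib-+ (λ j → if does (i ≟ u) then 𝟙[ e u j ] else 0) _) ⟩
    sumFin (λ i → sumFin (λ j → if does (i ≟ u) then 𝟙[ e u j ] else 0)
                + sumFin (λ j → if does (j ≟ u) then 𝟙[ e i u ] else 0))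
      ≡⟨ sumFin-cong (λ i → cong₂ _+_ (sumFin-if (does (i ≟ u)) (λ j → 𝟙[ e u j ])) (sumFin-single u 𝟙[ e i u ])) ⟩
    sumFin (λ i → (if does (i ≟ u) then sumFin (λ j → 𝟙[ e u j ]) else 0) + 𝟙[ e i u ])
      ≡⟨ sumFin-distrib-+ (λ i → if does (i ≟ u) then sumFin (λ j → 𝟙[ e u j ]) else 0) _ ⟩
    sumFin (λ i → if does (i ≟ u) then sumFin (λ j → 𝟙[ e u j ]) else 0) + sumFin (λ i → 𝟙[ e i u ])
      ≡⟨ cong₂ _+_ (sumFin-single u _) (sumFin-cong (λ i → cong 𝟙[_] (adj-sym (G [ S ]) i u))) ⟩
    sumFin (λ j → 𝟙[ e u j ]) + sumFin (λ j → 𝟙[ e u j ])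
      ≡⟨ cong₂ _+_ (sym (count≡sumFin (e u))) (trans (sym (count≡sumFin (e u))) (sym (+-identityʳ d))) ⟩
    2 * d ∎
    where open ≡-Reasoning

Closed : ∀ {n} → (Fin n → Fin n → Set) → (Fin n → Bool) → Set
Closed R C = ∀ {z w} → C z ≡ true → R z w → C w ≡ true

degreeSum-separate : ∀ {n} (G : Graph n) (S C X : Fin n → Bool) → Closed (StepAvoiding (induced G S) X) C →
                     degreeSum (G [ S ]) ≤ degreeSum (G [ S ∩ (C ∪ X) ]) + degreeSum (G [ S ∩ ∁ C ])
degreeSum-separate G S C X closed = begin
  degreeSum (G [ S ])                                  ≡⟨ degreeSum≡sumFin² (G [ S ]) ⟩
  sumFin (λ i → sumFin (λ j → 𝟙[ adj (G [ S ]) i j ])) ≤⟨ sumFin²-mono split ⟩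
  sumFin (λ i → sumFin (λ j → 𝟙[ adj (G [ S ∩ (C ∪ X) ]) i j ]))
    + sumFin (λ i → sumFin (λ j → 𝟙[ adj (G [ S ∩ ∁ C ]) i j ]))
                                                       ≡⟨ sym (cong₂ _+_ (degreeSum≡sumFin² (G [ S ∩ (C ∪ X) ]))
                                                                         (degreeSum≡sumFin² (G [ S ∩ ∁ C ]))) ⟩
  degreeSum (G [ S ∩ (C ∪ X) ]) + degreeSum (G [ S ∩ ∁ C ]) ∎
  where
  open ≤-Reasoning
  -- An edge leaving C can only end in X, so every edge of G[S] lies in one of the two sides.
  separated : ∀ s t a c d x y →
    (s ∧ t ∧ a ≡ true → c ≡ true → y ≡ false → d ≡ true) →
    (s ∧ t ∧ a ≡ true → d ≡ true → x ≡ false → c ≡ true) →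
    𝟙[ s ∧ t ∧ a ] ≤ 𝟙[ (s ∧ (c ∨ x)) ∧ (t ∧ (d ∨ y)) ∧ a ] + 𝟙[ (s ∧ not c) ∧ (t ∧ not d) ∧ a ]
  separated false t     a     c     d     x     y     _  _  = z≤n
  separated true  false a     c     d     x     y     _  _  = z≤n
  separated true  true  false c     d     x     y     _  _  = z≤n
  separated true  true  true  true  true  x     y     _  _  = s≤s z≤n
  separated true  true  true  true  false x     true  _  _  = s≤s z≤n
  separated true  true  true  true  false x     false c→d _ with () ← c→d refl refl refl
  separated true  true  true  false true  true  y     _  _  = s≤s z≤n
  separated true  true  true  false true  false y     _  d→c with () ← d→c refl refl refl
  separated true  true  true  false false x     y     _  _  = m≤n+m 1 _

  split : ∀ i j → 𝟙[ adj (G [ S ]) i j ] ≤ 𝟙[ adj (G [ S ∩ (C ∪ X) ]) i j ] + 𝟙[ adj (G [ S ∩ ∁ C ]) i j ]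
  split i j = separated (S i) (S j) (adj G i j) (C i) (C j) (X i) (X j)
    (λ e Ci Xj → closed Ci (e , Xj))
    (λ e Cj Xi → closed Cj (trans (adj-sym (G [ S ]) j i) e , Xi))

order-separate : ∀ {n} (S C X : Fin n → Bool) → count (S ∩ (C ∪ X)) + count (S ∩ ∁ C) ≤ count S + count X
order-separate S C X = subst₂ _≤_
  (trans (sumFin-distrib-+ (λ i → 𝟙[ (S ∩ (C ∪ X)) i ]) _)
         (sym (cong₂ _+_ (count≡sumFin (S ∩ (C ∪ X))) (count≡sumFin (S ∩ ∁ C)))))
  (trans (sumFin-distrib-+ (λ i → 𝟙[ S i ]) _) (sym (cong₂ _+_ (count≡sumFin S) (count≡sumFin X))))
  (sumFin-mono-≤ (λ i → sides (S i) (C i) (X i)))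
  where
  sides : ∀ s c x → 𝟙[ s ∧ (c ∨ x) ] + 𝟙[ s ∧ not c ] ≤ 𝟙[ s ] + 𝟙[ x ]
  sides false c     x = z≤n
  sides true  true  x = m≤m+n 1 𝟙[ x ]
  sides true  false x = ≤-reflexive (+-comm 𝟙[ x ] 1)

-- Cuts

cutGraph : ∀ {n} → Graph n → (Fin n → Bool) → Graph n
adj (cutGraph G c) i j = adj G i j ∧ (c i xor c j)
adj-sym (cutGraph G c) i j = cong₂ _∧_ (adj-sym G i j) (xor-comm (c i) (c j))
  where
  xor-comm : ∀ x y → x xor y ≡ y xor x
  xor-comm false false = refl
  xor-comm false true  = refl
  xor-comm true  false = refl
  xor-comm true  true  = refl
adj-irrefl (cutGraph G c) i = cong (_∧ (c i xor c i)) (adj-irrefl G i)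

cutGraph⊆ᴳ : ∀ {n} (G : Graph n) c → cutGraph G c ⊆ᴳ G
cutGraph⊆ᴳ G c i j = ∧-elimˡ

cut-bipartite : ∀ {n} {G : Graph n} c (H : Subgraph (cutGraph G c)) → IsBipartite H
cut-bipartite {G = G} c H = c , λ i j e → xor⇒≢ (∧-elimʳ {adj G i j} (edge-sub H i j e))
  where
  xor⇒≢ : ∀ {x y} → x xor y ≡ true → x ≢ y
  xor⇒≢ {false} {false} () _
  xor⇒≢ {true}  {true}  () _

tailGraph : ∀ {n} → Graph (suc n) → Graph n
adj (tailGraph G) i j = adj G (fsuc i) (fsuc j)
adj-sym (tailGraph G) i j = adj-sym G (fsuc i) (fsuc j)
adj-irrefl (tailGraph G) i = adj-irrefl G (fsuc i)

+≤2*max : ∀ a b → a + b ≤ 2 * a ⊎ a + b ≤ 2 * b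
+≤2*max a b with ≤-total a b
... | inj₁ a≤b = inj₂ (subst (a + b ≤_) (cong (b +_) (sym (+-identityʳ b))) (+-monoˡ-≤ b a≤b))
... | inj₂ b≤a = inj₁ (subst (a + b ≤_) (cong (a +_) (sym (+-identityʳ a))) (+-monoʳ-≤ a b≤a))

majorityColour : ∀ {n} (N c : Fin n → Bool) → Σ[ b ∈ Bool ] count N ≤ 2 * count (λ j → N j ∧ (b xor c j))
majorityColour N c with +≤2*max (count (λ j → N j ∧ not (c j))) (count (λ j → N j ∧ c j))
... | inj₁ N≤2a = true  , subst (_≤ 2 * count (λ j → N j ∧ not (c j))) (count-split N c) N≤2a
... | inj₂ N≤2b = false , subst (_≤ 2 * count (λ j → N j ∧ c j)) (count-split N c) N≤2b

maxCut : ∀ {n} (G : Graph n) → Σ[ c ∈ (Fin n → Bool) ] edgeCount G ≤ 2 * edgeCount (cutGraph G c)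
maxCut {zero}  G = (λ ()) , z≤n
maxCut {suc n} G with maxCut (tailGraph G)
... | c , tail-cut with majorityColour (λ j → adj G fzero (fsuc j)) c
...   | b , first-cut = b ∷ c , subst (edgeCount G ≤_)
        (sym (*-distribˡ-+ 2 (count (λ j → adj G fzero (fsuc j) ∧ (b xor c j))) (edgeCount (cutGraph (tailGraph G) c))))
        (+-mono-≤ first-cut tail-cut)

-- Reachability

module _ {n : ℕ} {R : Fin n → Fin n → Set} (R? : ∀ z w → Dec (R z w)) (u : Fin n) where

  ReachedFrom : (Fin n → Bool) → Set
  ReachedFrom C = C u ≡ true × (∀ w → C w ≡ true → Star R u w)

  private
    grow : ∀ fuel C → n ≤ count C + fuel → ReachedFrom C → Σ[ C′ ∈ (Fin n → Bool) ] ReachedFrom C′ × Closed R C′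
    grow fuel C bound reached@(Cu , walks)
      with any? (λ z → any? (λ w → (C z ≟ᵇ true) ×-dec R? z w ×-dec (C w ≟ᵇ false)))
    ... | no noExit = C , reached , closed
      where
      closed : Closed R C
      closed {z} {w} Cz r with C w in Cw
      ... | true  = refl
      ... | false = ⊥-elim (noExit (z , w , Cz , r , Cw))
    ... | yes (z , w , Cz , r , Cw) = extend fuel bound
      where
      C′ : Fin n → Bool
      C′ = C ∪ ⁅ w ⁆

      C⊆C′ : C ⊆ C′
      C⊆C′ i Ci rewrite Ci = refl

      C<C′ : count C < count C′
      C<C′ = count-mono-< C⊆C′ w Cw (trans (cong (C w ∨_) (dec-true (w ≟ w) refl)) (∨-zeroʳ (C w)))

      reached′ : ReachedFrom C′
      reached′ = C⊆C′ u Cu , walk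
        where
        walk : ∀ y → C′ y ≡ true → Star R u y
        walk y C′y with C y in Cy
        ... | true  = walks y Cy
        ... | false with refl ← ∈⁅⁆⇒≡ {i = y} {w} C′y = walks z Cz ◅◅ (r ◅ ε)

      extend : ∀ fuel → n ≤ count C + fuel → Σ[ C′ ∈ (Fin n → Bool) ] ReachedFrom C′ × Closed R C′
      extend zero bound =
        ⊥-elim (<-irrefl refl (<-≤-trans C<C′ (≤-trans (count≤n C′) (subst (n ≤_) (+-identityʳ (count C)) bound))))
      extend (suc fuel) bound =
        grow fuel C′ (≤-trans bound (≤-trans (≤-reflexive (+-suc (count C) fuel)) (+-monoˡ-≤ fuel C<C′))) reached′

  reachableClosure : Σ[ C ∈ (Fin n → Bool) ] ReachedFrom C × Closed R C
  reachableClosure = grow n ⁅ u ⁆ (m≤n+m n (count ⁅ u ⁆)) (dec-true (u ≟ u) refl , start)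
    where
    start : ∀ w → ⁅ u ⁆ w ≡ true → Star R u w
    start w w∈⁅u⁆ with refl ← ∈⁅⁆⇒≡ {i = w} {u} w∈⁅u⁆ = ε

-- Minimum dense vertex sets

separation-absurd : ∀ {g q s x d d₁ d₂ s₁ s₂} → g * x ≤ q → g * s < d + q → d ≤ d₁ + d₂ →
                    d₁ + q ≤ g * s₁ → d₂ + q ≤ g * s₂ → s₁ + s₂ ≤ s + x → ⊥
separation-absurd {g} {q} {s} {x} {d} {d₁} {d₂} {s₁} {s₂} gx≤q dense split sparse₁ sparse₂ sides =
  <-irrefl refl (begin-strict
    g * s + q             <⟨ +-monoˡ-< q dense ⟩
    d + q + q             ≤⟨ +-monoˡ-≤ q (+-monoˡ-≤ q split) ⟩
    d₁ + d₂ + q + q       ≡⟨ regroup d₁ d₂ q ⟩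
    (d₁ + q) + (d₂ + q)   ≤⟨ +-mono-≤ sparse₁ sparse₂ ⟩
    g * s₁ + g * s₂       ≡⟨ sym (*-distribˡ-+ g s₁ s₂) ⟩
    g * (s₁ + s₂)         ≤⟨ *-monoʳ-≤ g sides ⟩
    g * (s + x)           ≡⟨ *-distribˡ-+ g s x ⟩
    g * s + g * x         ≤⟨ +-monoʳ-≤ (g * s) gx≤q ⟩
    g * s + q             ∎)
  where
  open ≤-Reasoning
  regroup : ∀ a b c → a + b + c + c ≡ (a + c) + (b + c)
  regroup = solve-∀

module _ {n : ℕ} (B : Graph n) (k : ℕ) where

  -- e(B[S]) > 2k|S| − 2k², written with degreeSum = 2e and without truncated subtraction.
  Dense : (Fin n → Bool) → Set
  Dense S = 2 * k ≤ count S × 4 * k * count S < degreeSum (B [ S ]) + 4 * k * k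

  MinimumDense : (Fin n → Bool) → Set
  MinimumDense S = Dense S × (∀ T → count T < count S → ¬ Dense T)

  dense? : ∀ S → Dec (Dense S)
  dense? S = 2 * k ≤? count S ×-dec 4 * k * count S <? degreeSum (B [ S ]) + 4 * k * k

  dense-cong : ∀ {S T} → (∀ i → S i ≡ T i) → Dense S → Dense T
  dense-cong S≗T (2k≤S , dense) =
    subst (2 * k ≤_) (count-cong S≗T) 2k≤S ,
    subst₂ (λ s d → 4 * k * s < d + 4 * k * k) (count-cong S≗T) (degreeSum-cong B S≗T) dense

  ¬dense⇒sparse : ∀ {S} → ¬ Dense S → 2 * k ≤ count S → degreeSum (B [ S ]) + 4 * k * k ≤ 4 * k * count S
  ¬dense⇒sparse ¬dense 2k≤S = ≮⇒≥ (λ dense → ¬dense (2k≤S , dense))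

  dense⇒minimumDense : ∀ {S} → Dense S → Σ[ T ∈ (Fin n → Bool) ] MinimumDense T
  dense⇒minimumDense {S} = below (count S) S ≤-refl
    where
    below : ∀ m T → count T ≤ m → Dense T → Σ[ U ∈ (Fin n → Bool) ] MinimumDense U
    below m T T≤m dense with anySubset? (λ v → count (lookup v) <? count T ×-dec dense? (lookup v))
    ... | no none = T , dense , λ U U<T denseU →
      none (tabulate U , subst (_< count T) (count-cong (U≗ U)) U<T , dense-cong (U≗ U) denseU)
      where
      U≗ : ∀ U i → U i ≡ lookup (tabulate U) i
      U≗ U i = sym (lookup∘tabulate U i)
    below zero    T T≤0 dense | yes (v , v<T , _)      = ⊥-elim (n≮0 (<-≤-trans v<T T≤0))
    below (suc m) T T≤m dense | yes (v , v<T , denseV) = below m (lookup v) (s≤s⁻¹ (<-≤-trans v<T T≤m)) denseV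

  whole-dense : 1 ≤ k → 1 ≤ n → 4 * k * n ≤ degreeSum B → Dense (λ _ → true)
  whole-dense 1≤k 1≤n 4kn≤D =
    subst (2 * k ≤_) (sym (count-all n)) 2k≤n ,
    subst (λ s → 4 * k * s < degreeSum B + 4 * k * k) (sym (count-all n)) (≤-<-trans 4kn≤D (m<m+n (degreeSum B) 0<4kk))
    where
    0<4kk : 0 < 4 * k * k
    0<4kk = *-mono-≤ (≤-trans 1≤k (m≤n*m k 4)) 1≤k

    n+4kn≤n² : suc (4 * k) * n ≤ n * n
    n+4kn≤n² = begin
      n + 4 * k * n     ≡⟨ +-comm n (4 * k * n) ⟩
      4 * k * n + n     ≤⟨ +-monoˡ-≤ n 4kn≤D ⟩
      degreeSum B + n   ≤⟨ subst₂ (λ s s′ → degreeSum B + s ≤ s′ * s′) (count-all n) (count-all n)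
                                   (degreeSum+order≤order² B (λ _ → true)) ⟩
      n * n             ∎
      where open ≤-Reasoning

    2k≤n : 2 * k ≤ n
    2k≤n = ≤-trans (*-monoˡ-≤ k (m≤m+n 2 2)) (≤-trans (n≤1+n (4 * k))
             (*-cancelʳ-≤ (suc (4 * k)) n n {{>-nonZero 1≤n}} n+4kn≤n²))

  dense⇒2k<order : ∀ {S} → Dense S → 2 * k < count S
  dense⇒2k<order {S} (2k≤S , dense) with m≤n⇒m<n∨m≡n 2k≤S
  ... | inj₁ 2k<S = 2k<S
  ... | inj₂ 2k≡S = ⊥-elim (<-irrefl refl (begin-strict
    4 * k * s                         <⟨ dense ⟩
    D + 4 * k * k                     ≤⟨ +-monoˡ-≤ (4 * k * k) (m≤m+n D s) ⟩
    D + s + 4 * k * k                 ≤⟨ +-monoˡ-≤ (4 * k * k) (degreeSum+order≤order² B S) ⟩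
    s * s + 4 * k * k                 ≡⟨ cong (λ t → t * t + 4 * k * k) (sym 2k≡S) ⟩
    2 * k * (2 * k) + 4 * k * k       ≡⟨ square k ⟩
    4 * k * (2 * k)                   ≡⟨ cong (4 * k *_) 2k≡S ⟩
    4 * k * s                         ∎))
    where
    open ≤-Reasoning
    s D : ℕ
    s = count S
    D = degreeSum (B [ S ])
    square : ∀ k → 2 * k * (2 * k) + 4 * k * k ≡ 4 * k * (2 * k)
    square = solve-∀

  minimumDense⇒2k<degree : ∀ {S u} → MinimumDense S → S u ≡ true → 2 * k < degree (B [ S ]) u
  minimumDense⇒2k<degree {S} {u} (dense , minimal) Su with 2 * k <? degree (B [ S ]) u
  ... | yes 2k<deg = 2k<deg
  ... | no  2k≮deg = ⊥-elim (minimal (S ─ u) (≤-reflexive (sym |S|≡)) (2k≤S─u , dense-S─u))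
    where
    open ≤-Reasoning
    |S|≡ : count S ≡ suc (count (S ─ u))
    |S|≡ = count-remove {S = S} {u} Su

    2k≤S─u : 2 * k ≤ count (S ─ u)
    2k≤S─u = s≤s⁻¹ (subst (2 * k <_) |S|≡ (dense⇒2k<order dense))

    2deg≤4k : 2 * degree (B [ S ]) u ≤ 4 * k
    2deg≤4k = ≤-trans (*-monoʳ-≤ 2 (≮⇒≥ 2k≮deg)) (≤-reflexive (sym (*-assoc 2 2 k)))

    dense-S─u : 4 * k * count (S ─ u) < degreeSum (B [ S ─ u ]) + 4 * k * k
    dense-S─u = +-cancelˡ-< (4 * k) _ _ (begin-strict
      4 * k + 4 * k * count (S ─ u)                                ≡⟨ sym (*-suc (4 * k) _) ⟩
      4 * k * suc (count (S ─ u))                                  ≡⟨ cong (4 * k *_) (sym |S|≡) ⟩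
      4 * k * count S                                              <⟨ proj₂ dense ⟩
      degreeSum (B [ S ]) + 4 * k * k                              ≤⟨ +-monoˡ-≤ (4 * k * k) (degreeSum-remove B S u) ⟩
      degreeSum (B [ S ─ u ]) + 2 * degree (B [ S ]) u + 4 * k * k ≤⟨ +-monoˡ-≤ (4 * k * k)
                                                                        (+-monoʳ-≤ (degreeSum (B [ S ─ u ])) 2deg≤4k) ⟩
      degreeSum (B [ S ─ u ]) + 4 * k + 4 * k * k                  ≡⟨ rearrange (degreeSum (B [ S ─ u ])) (4 * k) _ ⟩
      4 * k + (degreeSum (B [ S ─ u ]) + 4 * k * k)                ∎)
      where
      rearrange : ∀ a b c → a + b + c ≡ b + (a + c)
      rearrange = solve-∀

  minimumDense-unseparable : ∀ {S X C u v} → MinimumDense S → count X ≤ k →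
                             Closed (StepAvoiding (induced B S) X) C →
                             S u ≡ true → C u ≡ true → S v ≡ true → C v ≡ false → X v ≡ false → ⊥
  minimumDense-unseparable {S} {X} {C} {u} {v} minimum@(dense , minimal) X≤k closed Su Cu Sv Cv Xv =
    separation-absurd {g = 4 * k} {s = count S} {x = count X} {s₁ = count (S ∩ (C ∪ X))} {s₂ = count (S ∩ ∁ C)}
      (*-monoʳ-≤ (4 * k) X≤k) (proj₂ dense) (degreeSum-separate B S C X closed)
      (sparse-side (S ∩ (C ∪ X)) Su S₁<S N[u]⊆S₁) (sparse-side (S ∩ ∁ C) Sv S₂<S N[v]⊆S₂)
      (order-separate S C X)
    where
    sparse-side : ∀ T {w} → S w ≡ true → count T < count S → adj (B [ S ]) w ⊆ T →
                  degreeSum (B [ T ]) + 4 * k * k ≤ 4 * k * count T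
    sparse-side T Sw T<S N⊆T =
      ¬dense⇒sparse (minimal T T<S) (<⇒≤ (<-≤-trans (minimumDense⇒2k<degree minimum Sw) (count-mono N⊆T)))

    S₁<S : count (S ∩ (C ∪ X)) < count S
    S₁<S = count-mono-< (λ _ → ∧-elimˡ) v (trans (cong₂ (λ c x → S v ∧ (c ∨ x)) Cv Xv) (∧-zeroʳ (S v))) Sv

    S₂<S : count (S ∩ ∁ C) < count S
    S₂<S = count-mono-< (λ _ → ∧-elimˡ) u (trans (cong (λ c → S u ∧ not c) Cu) (∧-zeroʳ (S u))) Su

    inside : ∀ {t c x} → t ≡ true → (x ≡ false → c ≡ true) → t ∧ (c ∨ x) ≡ true
    inside {true} {c} {true}  _ _   = ∨-zeroʳ c
    inside {true} {c} {false} _ x⇒c = trans (∨-identityʳ c) (x⇒c refl)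

    outside : ∀ {t c b} → t ≡ true → (c ≡ true → b ≡ true) → b ≡ false → t ∧ not c ≡ true
    outside {true} {false}         _ _   _ = refl
    outside {true} {true}  {false} _ c⇒b _ with () ← c⇒b refl

    N[u]⊆S₁ : adj (B [ S ]) u ⊆ (S ∩ (C ∪ X))
    N[u]⊆S₁ j e = inside (∧-elimˡ (∧-elimʳ {S u} e)) (λ Xj → closed Cu (e , Xj))

    N[v]⊆S₂ : adj (B [ S ]) v ⊆ (S ∩ ∁ C)
    N[v]⊆S₂ j e = outside (∧-elimˡ (∧-elimʳ {S v} e)) (λ Cj → closed Cj (trans (adj-sym (B [ S ]) j v) e , Xv)) Cv

  minimumDense⇒kConnected : 1 ≤ k → ∀ {S} → MinimumDense S → IsKConnected (suc k) (induced B S)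
  minimumDense⇒kConnected 1≤k {S} minimum = ≤-<-trans k+1≤2k (dense⇒2k<order (proj₁ minimum)) , connected
    where
    k+1≤2k : suc k ≤ 2 * k
    k+1≤2k = subst (suc k ≤_) (cong (k +_) (sym (+-identityʳ k))) (+-monoˡ-≤ k 1≤k)

    connected : ∀ X → count X < suc k → ConnectedMinus (induced B S) X
    connected X X<k+1 u v (Su , _) (Sv , Xv)
      with reachableClosure {R = StepAvoiding (induced B S) X} (λ z w → (adj (B [ S ]) z w ≟ᵇ true) ×-dec (X w ≟ᵇ false)) u
    ... | C , (Cu , walks) , closed with C v in Cv
    ...   | true  = walks v Cv
    ...   | false = ⊥-elim (minimumDense-unseparable minimum (s≤s⁻¹ X<k+1) closed Su Cu Sv Cv Xv)

mainTheorem1 : (k : ℕ) → 1 ≤ k → (n : ℕ) → (G : Graph n) → AvgDegreeAtLeast G (8 * k)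
               → Σ (Subgraph G) λ H → IsBipartite H × IsKConnected (suc k) H
mainTheorem1 k 1≤k n G (1≤n , 8kn≤2e) =
  let S , minimum = dense⇒minimumDense B k (whole-dense B k 1≤k 1≤n 4kn≤degreeSum)
  in Subgraph-mono (cutGraph⊆ᴳ G c) (induced B S) ,
     cut-bipartite c (induced B S) ,
     minimumDense⇒kConnected B k 1≤k minimum
  where
  c : Fin n → Bool
  c = proj₁ (maxCut G)
  B : Graph n
  B = cutGraph G c

  4kn≤degreeSum : 4 * k * n ≤ degreeSum B
  4kn≤degreeSum = begin
    4 * k * n           ≤⟨ *-cancelˡ-≤ 2 (subst (_≤ 2 * edgeCount G) (eight k n) 8kn≤2e) ⟩
    edgeCount G         ≤⟨ proj₂ (maxCut G) ⟩
    2 * edgeCount B     ≤⟨ 2*edgeCount≤degreeSum B ⟩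
    degreeSum B         ∎
    where
    open ≤-Reasoning
    eight : ∀ k n → 8 * k * n ≡ 2 * (4 * k * n)
    eight = solve-∀
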